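{- Let $T^a$ be the tree with vertex set $\{1,2,3,4,5,6,7\}$ and edge set $\{12,13,24,25,36,37\}$. Then $\mathrm{sp}^*(T^a,E(T^a))=4$.
   Context: A path in a graph is a sequence of distinct vertices with consecutive ones adjacent; it contains the edges between consecutive vertices. For a family $\mathcal F$ of paths and an edge $e$, $\mathcal F(e)$ is the set of paths containing $e$. $\mathcal F$ separates $E$ if $\mathcal F(e)\neq\mathcal F(f)$ for distinct edges $e,f$, and covers $E$ if every $\mathcal F(e)$ is nonempty. $\mathrm{sp}^*(G,E(G))$ is the minimum size of a family of paths in $G$ that separates and covers $E(G)$. -}

module Defs where

open import Data.Nat using (ℕ; _≤_)
open import Data.Fin using (Fin; zero; suc; #_)
open import Data.List using (List; []; _∷_; length; lookup)
open import Data.Unit using (⊤)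
open import Data.Empty using (⊥)
open import Data.List.Membership.Propositional using (_∈_)
open import Data.List.Relation.Unary.Unique.Propositional using (Unique)
open import Data.List.Relation.Unary.Any using (Any)
open import Data.Product using (Σ; _×_; _,_; ∃)
open import Data.Sum using (_⊎_)
open import Relation.Binary.PropositionalEquality using (_≡_)
open import Relation.Nullary using (¬_)

-- A finite simple graph on vertex set Fin n, with edge set given as a list
-- of (unordered) edges, each written as a pair of endpoints.
record Graph : Set where
  field
    n     : ℕ
    edges : List (Fin n × Fin n)
open Graph public

Vertex : Graph → Set
Vertex G = Fin (n G)

Adj : (G : Graph) → Vertex G → Vertex G → Set
Adj G u v = ((u , v) ∈ edges G) ⊎ ((v , u) ∈ edges G)

Walk : (G : Graph) → List (Vertex G) → Set
Walk G []           = ⊤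
Walk G (u ∷ [])     = ⊤
Walk G (u ∷ v ∷ vs) = Adj G u v × Walk G (v ∷ vs)

record Path (G : Graph) : Set where
  constructor mkPath
  field
    verts    : List (Vertex G)
    nonempty : ¬ (verts ≡ [])
    distinct : Unique verts
    walk     : Walk G verts
open Path public

Traverses : {A : Set} → List A → A → A → Set
Traverses []           a b = ⊥
Traverses (u ∷ [])     a b = ⊥
Traverses (u ∷ v ∷ vs) a b =
  ((u ≡ a × v ≡ b) ⊎ (u ≡ b × v ≡ a)) ⊎ Traverses (v ∷ vs) a b

Contains : (G : Graph) → Path G → Vertex G × Vertex G → Set
Contains G P (a , b) = Traverses (verts P) a b

Family : Graph → Set
Family G = List (Path G)

-- F(e) = F(f) as sets of paths in the family (compared by index in the family)
SameSet : (G : Graph) → Family G → (e f : Vertex G × Vertex G) → Set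
SameSet G F e f =
  ∀ (i : Fin (length F)) →
    (Contains G (lookup F i) e → Contains G (lookup F i) f) ×
    (Contains G (lookup F i) f → Contains G (lookup F i) e)

Separates : (G : Graph) → Family G → Set
Separates G F =
  ∀ {e f} → e ∈ edges G → f ∈ edges G → ¬ (e ≡ f) → ¬ SameSet G F e f

Covers : (G : Graph) → Family G → Set
Covers G F = ∀ {e} → e ∈ edges G → Any (λ P → Contains G P e) F

SepCov : (G : Graph) → Family G → Set
SepCov G F = Separates G F × Covers G F

SpStarIs : Graph → ℕ → Set
SpStarIs G k =
  (Σ (Family G) λ F → SepCov G F × length F ≡ k) ×
  (∀ (F : Family G) → SepCov G F → k ≤ length F)

-- The tree T^a: vertices 1..7 (encoded as Fin 7, vertex i ↦ i-1),
-- edges 12, 13, 24, 25, 36, 37.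
Ta : Graph
Ta = record
  { n = 7
  ; edges = (# 0 , # 1) ∷ (# 0 , # 2) ∷ (# 1 , # 3) ∷ (# 1 , # 4)
          ∷ (# 2 , # 5) ∷ (# 2 , # 6) ∷ []
  }

-- The sets F(e) are the columns of the 0/1 matrix whose rows are the edge sets of the
-- paths of F, so F separates and covers exactly when these columns are nonzero and pairwise
-- distinct: a property of the list of rows alone. Three rows allow seven nonzero columns,
-- so counting does not rule out three paths for the six edges of T^a. Instead, every path
-- of T^a has one of 22 edge sets (one per pair of endpoints, and the empty set), found by
-- a list of vertex sequences closed under extension by an adjacent new vertex, and an
-- exhaustive search shows that no three of them separate and cover. Four paths do.
module Submission where

open import Defs
open import Data.Bool using (Bool; true; false; T)
import Data.Bool.Properties as Bool
open import Data.Empty using (⊥-elim)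
open import Data.Fin using (Fin; zero; suc; #_)
import Data.Fin.Properties as Fin
open import Data.List using (List; []; _∷_; [_]; length; lookup; map; filter; concat; concatMap; iterate; allFin; deduplicate)
open import Data.List.Membership.Propositional using (_∈_; _∉_)
open import Data.List.Membership.Propositional.Properties using (∈-map⁺; ∈-filter⁺; ∈-allFin; ∈-lookup; ∈-deduplicate⁺)
import Data.List.Membership.DecPropositional as DecMembership
open import Data.List.Relation.Unary.All as All using (All; []; _∷_)
open import Data.List.Relation.Unary.All.Properties using (All¬⇒¬Any)
import Data.List.Relation.Unary.All.Properties as All
open import Data.List.Relation.Unary.Any as Any using (Any; there)
import Data.List.Relation.Unary.Any.Properties as Any
open import Data.List.Relation.Unary.AllPairs using (_∷_)
open import Data.List.Relation.Unary.Unique.Propositional using (Unique)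
import Data.List.Relation.Unary.Unique.DecPropositional as DecUnique
import Data.List.Properties as List
open import Data.Nat using (_≤_; s≤s)
open import Data.Nat.Properties using (≰⇒>)
open import Data.Product using (_×_; _,_; proj₁; proj₂)
import Data.Product.Properties as Product
open import Data.Unit using (tt)
open import Data.Vec using (Vec; tabulate) renaming (lookup to _!_)
import Data.Vec.Properties as Vec
open import Function using (_∘_; const)
open import Function.Bundles using (_⇔_; mk⇔; Equivalence)
import Function.Properties.Equivalence as ⇔
open import Relation.Binary.Definitions using (DecidableEquality)
open import Relation.Binary.PropositionalEquality using (_≡_; _≢_; refl; sym; trans; subst; subst₂)
open import Relation.Nullary using (¬_; Dec; yes; no; does; _×-dec_; _⊎-dec_; _→-dec_; ¬?)
open import Relation.Nullary.Decidable using (True; from-yes)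
import Relation.Nullary.Decidable as Dec
open import Relation.Unary using (Decidable)

open Equivalence using (to; from)

T-does⇔ : ∀ {a} {A : Set a} (a? : Dec A) → T (does a?) ⇔ A
T-does⇔ (yes a) = mk⇔ (const a) (const tt)
T-does⇔ (no ¬a) = mk⇔ (λ ()) ¬a

T-injective : ∀ {a b} → T a ⇔ T b → a ≡ b
T-injective {false} {false} _ = refl
T-injective {false} {true}  h = ⊥-elim (from h tt)
T-injective {true}  {false} h = ⊥-elim (to h tt)
T-injective {true}  {true}  _ = refl

All⇔lookup : ∀ {a p} {A : Set a} {P : A → Set p} {xs : List A} →
             All P xs ⇔ (∀ i → P (lookup xs i))
All⇔lookup {P = P} = mk⇔ (λ all i → All.lookup all (∈-lookup i)) fromLookup
  where
  fromLookup : ∀ {xs} → (∀ i → P (lookup xs i)) → All P xs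
  fromLookup {[]}    _ = []
  fromLookup {_ ∷ _} h = h zero ∷ fromLookup (h ∘ suc)

module _ {A : Set} (_≟_ : DecidableEquality A) where

  traverses? : ∀ vs a b → Dec (Traverses vs a b)
  traverses? []           a b = no λ ()
  traverses? (u ∷ [])     a b = no λ ()
  traverses? (u ∷ v ∷ vs) a b =
    (((u ≟ a) ×-dec (v ≟ b)) ⊎-dec ((u ≟ b) ×-dec (v ≟ a))) ⊎-dec traverses? (v ∷ vs) a b

module _ (G : Graph) where

  EdgeIndex : Set
  EdgeIndex = Fin (length (edges G))

  edge : EdgeIndex → Vertex G × Vertex G
  edge = lookup (edges G)

  _≟ᵉ_ : DecidableEquality (Vertex G × Vertex G)
  _≟ᵉ_ = Product.≡-dec Fin._≟_ Fin._≟_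

  open DecMembership _≟ᵉ_ using () renaming (_∈?_ to _∈ᵉ?_)
  open DecMembership (Fin._≟_ {n G}) using (_∉?_)

  adjacent? : ∀ u v → Dec (Adj G u v)
  adjacent? u v = ((u , v) ∈ᵉ? edges G) ⊎-dec ((v , u) ∈ᵉ? edges G)

  walk? : Decidable (Walk G)
  walk? []           = yes tt
  walk? (u ∷ [])     = yes tt
  walk? (u ∷ v ∷ vs) = adjacent? u v ×-dec walk? (v ∷ vs)

  isPath? : (vs : List (Vertex G)) → Dec (Walk G vs × Unique vs × ¬ vs ≡ [])
  isPath? vs = walk? vs ×-dec DecUnique.unique? Fin._≟_ vs ×-dec ¬? (List.≡-dec Fin._≟_ vs [])

  fromVertices : (vs : List (Vertex G)) → {True (isPath? vs)} → Path G
  fromVertices vs {ok} = let walk , unique , nonempty = Dec.toWitness ok in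
    mkPath vs nonempty unique walk

  Row : Set
  Row = Vec Bool (length (edges G))

  traversesEdge? : ∀ vs k → Dec (Traverses vs (proj₁ (edge k)) (proj₂ (edge k)))
  traversesEdge? vs k = traverses? Fin._≟_ vs (proj₁ (edge k)) (proj₂ (edge k))

  incidence : List (Vertex G) → Row
  incidence vs = tabulate (does ∘ traversesEdge? vs)

  contains⇔incidence : ∀ P k → Contains G P (edge k) ⇔ T (incidence (verts P) ! k)
  contains⇔incidence P k rewrite Vec.lookup∘tabulate (does ∘ traversesEdge? (verts P)) k =
    ⇔.sym (T-does⇔ (traversesEdge? (verts P) k))

  Covering : List Row → Set
  Covering ts = ∀ k → Any (λ t → T (t ! k)) ts

  Agree : EdgeIndex → EdgeIndex → List Row → Set
  Agree k l ts = All (λ t → t ! k ≡ t ! l) ts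

  Separating : List Row → Set
  Separating ts = ∀ k l → edge k ≢ edge l → ¬ Agree k l ts

  SeparatingCovering : List Row → Set
  SeparatingCovering ts = Separating ts × Covering ts

  separatingCovering? : Decidable SeparatingCovering
  separatingCovering? ts = separating? ×-dec covering?
    where
    covering? = Fin.all? λ k → Any.any? (λ t → Bool.T? (t ! k)) ts
    separating? = Fin.all? λ k → Fin.all? λ l →
      ¬? (edge k ≟ᵉ edge l) →-dec ¬? (All.all? (λ t → t ! k Bool.≟ t ! l) ts)

  separatingCovering-∷ : ∀ {t ts} → SeparatingCovering ts → SeparatingCovering (t ∷ ts)
  separatingCovering-∷ (sep , cov) = (λ k l k≢l → sep k l k≢l ∘ All.tail) , there ∘ cov

  rows : Family G → List Row
  rows = map (incidence ∘ verts)

  sameContainment⇔agree : ∀ P k l →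
    ((Contains G P (edge k) → Contains G P (edge l)) × (Contains G P (edge l) → Contains G P (edge k)))
      ⇔ (incidence (verts P) ! k ≡ incidence (verts P) ! l)
  sameContainment⇔agree P k l = mk⇔
    (λ (k⇒l , l⇒k) → T-injective (mk⇔ (to ∼l ∘ k⇒l ∘ from ∼k) (to ∼k ∘ l⇒k ∘ from ∼l)))
    (λ eq → from ∼l ∘ subst T eq ∘ to ∼k , from ∼k ∘ subst T (sym eq) ∘ to ∼l)
    where
    ∼k = contains⇔incidence P k
    ∼l = contains⇔incidence P l

  sameSet⇔agree : ∀ F k l → SameSet G F (edge k) (edge l) ⇔ Agree k l (rows F)
  sameSet⇔agree F k l = mk⇔
    (λ same → All.map⁺ (from All⇔lookup λ i → to (sameContainment⇔agree (lookup F i) k l) (same i)))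
    (λ agree i → from (sameContainment⇔agree (lookup F i) k l) (to All⇔lookup (All.map⁻ agree) i))

  edge-index : ∀ {e} (e∈ : e ∈ edges G) → e ≡ edge (Any.index e∈)
  edge-index = Any.lookup-index

  separates⇔separating : ∀ F → Separates G F ⇔ Separating (rows F)
  separates⇔separating F = mk⇔
    (λ sep k l k≢l → sep (∈-lookup k) (∈-lookup l) k≢l ∘ from (sameSet⇔agree F k l))
    (λ sep {e} {f} e∈ f∈ e≢f same →
      sep (Any.index e∈) (Any.index f∈)
          (λ eq → e≢f (trans (edge-index e∈) (trans eq (sym (edge-index f∈)))))
          (to (sameSet⇔agree F _ _) (subst₂ (SameSet G F) (edge-index e∈) (edge-index f∈) same)))

  covers⇔covering : ∀ F → Covers G F ⇔ Covering (rows F)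
  covers⇔covering F = mk⇔
    (λ cov k → Any.map⁺ (Any.map (λ {P} → to (contains⇔incidence P k)) (cov (∈-lookup k))))
    (λ cov {e} e∈ → subst (λ e → Any (λ P → Contains G P e) F) (sym (edge-index e∈))
      (Any.map (λ {P} → from (contains⇔incidence P (Any.index e∈))) (Any.map⁻ (cov (Any.index e∈)))))

  sepCov⇔separatingCovering : ∀ F → SepCov G F ⇔ SeparatingCovering (rows F)
  sepCov⇔separatingCovering F = mk⇔
    (λ (sep , cov) → to (separates⇔separating F) sep , to (covers⇔covering F) cov)
    (λ (sep , cov) → from (separates⇔separating F) sep , from (covers⇔covering F) cov)

  sepCov? : Decidable (SepCov G)
  sepCov? F = Dec.map (⇔.sym (sepCov⇔separatingCovering F)) (separatingCovering? (rows F))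

  extensions : List (Vertex G) → List (List (Vertex G))
  extensions []       = []
  extensions (v ∷ vs) =
    map (_∷ v ∷ vs) (filter (λ u → adjacent? u v ×-dec u ∉? v ∷ vs) (allFin (n G)))

  ∈-extensions : ∀ {u v vs} → Adj G u v → u ∉ v ∷ vs → u ∷ v ∷ vs ∈ extensions (v ∷ vs)
  ∈-extensions {v = v} {vs} uv u∉ = ∈-map⁺ (_∷ v ∷ vs) (∈-filter⁺ _ (∈-allFin _) (uv , u∉))

  module _ (Ps : List (List (Vertex G)))
           (singletons : All (λ v → [ v ] ∈ Ps) (allFin (n G)))
           (closed : All (λ vs → All (_∈ Ps) (extensions vs)) Ps) where

    walk∈ : ∀ v vs → Unique (v ∷ vs) → Walk G (v ∷ vs) → v ∷ vs ∈ Ps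
    walk∈ v []       _              _           = All.lookup singletons (∈-allFin v)
    walk∈ u (v ∷ vs) (u∉ ∷ unique) (uv , walk) =
      All.lookup (All.lookup closed (walk∈ v vs unique walk)) (∈-extensions uv (All¬⇒¬Any u∉))

    verts∈ : (P : Path G) → verts P ∈ Ps
    verts∈ (mkPath []       nonempty _      _)    = ⊥-elim (nonempty refl)
    verts∈ (mkPath (v ∷ vs) _        unique walk) = walk∈ v vs unique walk

-- the number of rounds needs no justification: closure under extensions is checked below
pathsTa : List (List (Fin 7))
pathsTa = concat (iterate (concatMap (extensions Ta)) (map [_] (allFin 7)) 7)

verts∈pathsTa : (P : Path Ta) → verts P ∈ pathsTa
verts∈pathsTa = verts∈ Ta pathsTa
  (from-yes (All.all? (λ v → [ v ] ∈? pathsTa) (allFin 7)))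
  (from-yes (All.all? (λ vs → All.all? (_∈? pathsTa) (extensions Ta vs)) pathsTa))
  where open DecMembership (List.≡-dec Fin._≟_) using (_∈?_)

rowsTa : List (Row Ta)
rowsTa = deduplicate (Vec.≡-dec Bool._≟_) (map (incidence Ta) pathsTa)

row∈rowsTa : (P : Path Ta) → incidence Ta (verts P) ∈ rowsTa
row∈rowsTa P = ∈-deduplicate⁺ (Vec.≡-dec Bool._≟_) (∈-map⁺ (incidence Ta) (verts∈pathsTa P))

noThreeRowsSeparateAndCover : ∀ {a b c} → a ∈ rowsTa → b ∈ rowsTa → c ∈ rowsTa →
                              ¬ SeparatingCovering Ta (a ∷ b ∷ c ∷ [])
noThreeRowsSeparateAndCover a∈ b∈ c∈ =
  All.lookup (All.lookup (All.lookup (from-yes (noTriple? rowsTa)) a∈) b∈) c∈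
  where
  NoTriple : List (Row Ta) → Set
  NoTriple rs = All (λ a → All (λ b → All (λ c → ¬ SeparatingCovering Ta (a ∷ b ∷ c ∷ [])) rs) rs) rs

  -- abstracting over the list lets the evaluator compute rowsTa only once
  noTriple? : Decidable NoTriple
  noTriple? rs = All.all? (λ a → All.all? (λ b → All.all? (λ c →
    ¬? (separatingCovering? Ta (a ∷ b ∷ c ∷ []))) rs) rs) rs

noSmallSeparatingCovering : ∀ ts → All (_∈ rowsTa) ts → length ts ≤ 3 → ¬ SeparatingCovering Ta ts
noSmallSeparatingCovering []                  _                   _ (_ , cov) = Any.¬Any[] (cov zero)
noSmallSeparatingCovering (_ ∷ [])            (a ∷ [])            _ =
  noThreeRowsSeparateAndCover a a a ∘ separatingCovering-∷ Ta ∘ separatingCovering-∷ Ta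
noSmallSeparatingCovering (_ ∷ _ ∷ [])        (a ∷ b ∷ [])        _ =
  noThreeRowsSeparateAndCover a a b ∘ separatingCovering-∷ Ta
noSmallSeparatingCovering (_ ∷ _ ∷ _ ∷ [])    (a ∷ b ∷ c ∷ [])    _ = noThreeRowsSeparateAndCover a b c
noSmallSeparatingCovering (_ ∷ _ ∷ _ ∷ _ ∷ _) _ (s≤s (s≤s (s≤s ())))

sepCov⇒4≤length : ∀ F → SepCov Ta F → 4 ≤ length F
sepCov⇒4≤length F sc = ≰⇒> λ short →
  noSmallSeparatingCovering (rows Ta F)
    (All.map⁺ (All.tabulate λ {P} _ → row∈rowsTa P))
    (subst (_≤ 3) (sym (List.length-map _ F)) short)
    (to (sepCov⇔separatingCovering Ta F) sc)

-- the paths 1-2, 3-1-2-4, 5-2-1-3-6 and 5-2-1-3-7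
separatingCoverTa : Family Ta
separatingCoverTa =
    fromVertices Ta (# 0 ∷ # 1 ∷ [])
  ∷ fromVertices Ta (# 2 ∷ # 0 ∷ # 1 ∷ # 3 ∷ [])
  ∷ fromVertices Ta (# 4 ∷ # 1 ∷ # 0 ∷ # 2 ∷ # 5 ∷ [])
  ∷ fromVertices Ta (# 4 ∷ # 1 ∷ # 0 ∷ # 2 ∷ # 6 ∷ [])
  ∷ []

lemma5p1 : SpStarIs Ta 4
lemma5p1 = (separatingCoverTa , from-yes (sepCov? Ta separatingCoverTa) , refl) , sepCov⇒4≤length
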